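{- For every integer $m$ there exists a constant $N_m$ such that for every positive integer $n$: if $V$ is a subset of the $\mathbb{Z}_2$-vector space of subgraphs of $K_n$ which is useful for triangles and $|V| \leq 2^m$, then $n \leq N_m$.
   Context: Subgraphs of $K_n$ (on a fixed vertex set, identified with their edge sets) form a vector space over $\mathbb{Z}_2$ under symmetric difference. The agreement of $G_1,G_2$ is $(G_1\cap G_2)\cup(\overline{G_1}\cap\overline{G_2})$, where complements are with respect to $K_n$. A subset $V$ of size $2^{m'}$ (with $m'\ge 3$ an integer) is useful for triangles if every subset $S\subseteq V$ of size $2^{m'-3}+1$ contains two distinct vectors whose agreement is triangle-free. -}

module Defs where

open import Data.Nat using (ℕ; zero; suc; _+_; _∸_; _^_; _≤_)
open import Data.Bool using (Bool; true; false; not; _xor_)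
open import Data.Fin using (Fin; zero; suc)
open import Data.Vec using (Vec; lookup; zipWith)
open import Data.Unit using (⊤; tt)
open import Data.Product using (_×_; _,_; ∃-syntax)
open import Data.Empty using (⊥)
open import Data.List using (List; length)
open import Data.List.Relation.Unary.All using (All)
open import Data.List.Relation.Unary.Unique.Propositional using (Unique)
open import Data.List.Membership.Propositional using (_∈_)
open import Relation.Binary.PropositionalEquality using (_≡_; _≢_)

-- Canonical encoding (so that ≡ is equality of edge sets):
-- a graph on suc n vertices is (row , g) where g is a graph on the
-- vertices 1..n (shifted) and row lists, for each j : Fin n, whether
-- vertex 0 is adjacent to vertex (suc j).
Graph : ℕ → Set
Graph zero    = ⊤
Graph (suc n) = Vec Bool n × Graph n

adj : ∀ {n} → Graph n → Fin n → Fin n → Bool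
adj {suc n} (row , g) zero    zero    = false
adj {suc n} (row , g) zero    (suc j) = lookup row j
adj {suc n} (row , g) (suc i) zero    = lookup row i
adj {suc n} (row , g) (suc i) (suc j) = adj g i j

-- agreement (G1 ∩ G2) ∪ (complement G1 ∩ complement G2):
-- the edge e is present iff e ∈ G1 ⇔ e ∈ G2
agreement : ∀ {n} → Graph n → Graph n → Graph n
agreement {zero}  _          _          = tt
agreement {suc n} (r₁ , g₁) (r₂ , g₂) =
  zipWith (λ a b → not (a xor b)) r₁ r₂ , agreement g₁ g₂

TriangleFree : ∀ {n} → Graph n → Set
TriangleFree {n} G = (i j k : Fin n) →
  adj G i j ≡ true → adj G j k ≡ true → adj G i k ≡ true → ⊥

-- Finite sets of vectors are represented by duplicate-free lists;
-- cardinality is the length.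
-- S is a subset of V of the given size.
IsSubsetOfSize : ∀ {n} → List (Graph n) → List (Graph n) → ℕ → Set
IsSubsetOfSize S V k = Unique S × All (_∈ V) S × length S ≡ k

UsefulForTriangles : ∀ {n} → List (Graph n) → Set
UsefulForTriangles {n} V =
  ∃[ m' ] (3 ≤ m' × length V ≡ 2 ^ m' ×
    ((S : List (Graph n)) → IsSubsetOfSize S V (2 ^ (m' ∸ 3) + 1) →
      ∃[ G₁ ] ∃[ G₂ ] (G₁ ∈ S × G₂ ∈ S × G₁ ≢ G₂ × TriangleFree (agreement G₁ G₂))))

-- If n > 1 + 2^|V|, then by pigeonhole on the 2^|V| possible columns
-- (adj G 0 j)_{G ∈ V} there are vertices j ≠ l such that every G ∈ V has
-- the edge 0j iff it has the edge 0l. Splitting V twice by majority, on the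
-- edge 0j and then on the edge jl, leaves |V|/4 = 2^(m'-2) > 2^(m'-3) graphs
-- that pairwise agree on 0j and jl, hence also on 0l; the agreement of any two
-- of them contains the triangle 0jl, so V is not useful. Thus n ≤ 1 + 2^(2^m).
module Submission where

open import Defs
open import Data.Nat using (ℕ; _^_; _≤_)
open import Data.Product using (∃-syntax)
open import Data.List using (List; length)
open import Data.List.Relation.Unary.Unique.Propositional using (Unique)

open import Data.Nat using (suc; _+_; _*_; _∸_; _<_; s≤s)
open import Data.Nat.Properties
open import Data.Bool using (Bool; true; false; not; _xor_)
import Data.Bool as Bool
open import Data.Bool.Properties using (xor-same)
open import Data.Fin using (Fin)
import Data.Fin as Fin
import Data.Fin.Properties as Finₚ
open import Data.Vec.Properties using (lookup-zipWith)
open import Data.Product using (_×_; _,_; proj₁; proj₂)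
open import Data.Sum using (inj₁; inj₂)
open import Data.List using ([]; _∷_; filter; take)
open import Data.List.Properties using (length-take; length-tabulate)
open import Data.List.Relation.Unary.All using (All; []; _∷_)
import Data.List.Relation.Unary.All as All
open import Data.List.Relation.Unary.All.Properties using (take⁺)
open import Data.List.Relation.Unary.AllPairs using (_∷_)
open import Data.List.Relation.Unary.Any using (here; there)
import Data.List.Relation.Unary.Unique.Propositional.Properties as Unique
open import Data.List.Membership.Propositional using (_∈_)
open import Data.List.Membership.Propositional.Properties using (∈-filter⁻)
open import Function using (_∘_; id)
open import Relation.Binary.PropositionalEquality
open import Relation.Nullary using (¬_; contradiction)

adj-agreement : ∀ {n} (G₁ G₂ : Graph n) {i j : Fin n} → i ≢ j →
  adj (agreement G₁ G₂) i j ≡ not (adj G₁ i j xor adj G₂ i j)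
adj-agreement {suc n} _ _ {Fin.zero} {Fin.zero} i≢j = contradiction refl i≢j
adj-agreement {suc n} (r₁ , _) (r₂ , _) {Fin.zero} {Fin.suc j} _ = lookup-zipWith _ j r₁ r₂
adj-agreement {suc n} (r₁ , _) (r₂ , _) {Fin.suc i} {Fin.zero} _ = lookup-zipWith _ i r₁ r₂
adj-agreement {suc n} (_ , g₁) (_ , g₂) {Fin.suc i} {Fin.suc j} i≢j =
  adj-agreement g₁ g₂ (i≢j ∘ cong Fin.suc)

agreement-adj : ∀ {n} (G₁ G₂ : Graph n) {i j : Fin n} → i ≢ j →
  adj G₁ i j ≡ adj G₂ i j → adj (agreement G₁ G₂) i j ≡ true
agreement-adj G₁ G₂ {i} {j} i≢j same = begin
  adj (agreement G₁ G₂) i j            ≡⟨ adj-agreement G₁ G₂ i≢j ⟩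
  not (adj G₁ i j xor adj G₂ i j)      ≡⟨ cong (λ e → not (e xor adj G₂ i j)) same ⟩
  not (adj G₂ i j xor adj G₂ i j)      ≡⟨ cong not (xor-same (adj G₂ i j)) ⟩
  true                                 ∎
  where open ≡-Reasoning

agreement-triangle : ∀ {n} (G₁ G₂ : Graph n) {a b c : Fin n} →
  a ≢ b → b ≢ c → a ≢ c →
  adj G₁ a b ≡ adj G₂ a b → adj G₁ b c ≡ adj G₂ b c → adj G₁ a c ≡ adj G₂ a c →
  ¬ TriangleFree (agreement G₁ G₂)
agreement-triangle G₁ G₂ {a} {b} {c} a≢b b≢c a≢c ab bc ac triangle-free =
  triangle-free a b c
    (agreement-adj G₁ G₂ a≢b ab) (agreement-adj G₁ G₂ b≢c bc) (agreement-adj G₁ G₂ a≢c ac)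

m≤n⇒m+n≤2*n : ∀ {m n} → m ≤ n → m + n ≤ 2 * n
m≤n⇒m+n≤2*n {m} {n} m≤n = begin
  m + n        ≤⟨ +-monoˡ-≤ n m≤n ⟩
  n + n        ≡⟨ cong (n +_) (sym (+-identityʳ n)) ⟩
  2 * n        ∎
  where open ≤-Reasoning

n≤m⇒m+n≤2*m : ∀ {m n} → n ≤ m → m + n ≤ 2 * m
n≤m⇒m+n≤2*m {m} {n} n≤m = subst (_≤ 2 * m) (+-comm n m) (m≤n⇒m+n≤2*n n≤m)

module _ {A : Set} where

  fibre : (A → Bool) → Bool → List A → List A
  fibre p b = filter (λ x → p x Bool.≟ b)

  ∈-fibre⁻ : ∀ {p b x} {xs : List A} → x ∈ fibre p b xs → x ∈ xs × p x ≡ b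
  ∈-fibre⁻ {p} {b} = ∈-filter⁻ (λ x → p x Bool.≟ b)

  fibre⁺ : ∀ {p b} {xs : List A} → Unique xs → Unique (fibre p b xs)
  fibre⁺ {p} {b} = Unique.filter⁺ (λ x → p x Bool.≟ b)

  length-fibres : ∀ (p : A → Bool) (xs : List A) →
    length xs ≡ length (fibre p true xs) + length (fibre p false xs)
  length-fibres p [] = refl
  length-fibres p (x ∷ xs) with p x
  ... | true  = cong suc (length-fibres p xs)
  ... | false = trans (cong suc (length-fibres p xs)) (sym (+-suc _ _))

  majority-fibre : ∀ (p : A → Bool) (xs : List A) →
    ∃[ b ] (length xs ≤ 2 * length (fibre p b xs))
  majority-fibre p xs with ≤-total (length (fibre p true xs)) (length (fibre p false xs))
  ... | inj₁ t≤f = false , ≤-trans (≤-reflexive (length-fibres p xs)) (m≤n⇒m+n≤2*n t≤f)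
  ... | inj₂ f≤t = true , ≤-trans (≤-reflexive (length-fibres p xs)) (n≤m⇒m+n≤2*m f≤t)

take-isSubsetOfSize : ∀ {n} {xs : List (Graph n)} {k} → Unique xs → k ≤ length xs →
  IsSubsetOfSize (take k xs) xs k
take-isSubsetOfSize {xs = xs} {k} uniq k≤ =
  Unique.take⁺ k uniq , take⁺ k (All.tabulate id) , trans (length-take k xs) (m≤n⇒m⊓n≡m k≤)

columns-collide : ∀ {A B : Set} (h : A → B → Bool) (V : List A) {X : List B} → Unique X →
  2 ^ length V < length X →
  ∃[ j ] ∃[ l ] (j ∈ X × l ∈ X × j ≢ l × All (λ G → h G j ≡ h G l) V)
columns-collide h [] {x ∷ y ∷ _} ((x≢y ∷ _) ∷ _) _ = x , y , here refl , there (here refl) , x≢y , []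
columns-collide h [] {x ∷ []} _ (s≤s ())
columns-collide h (G ∷ V) {X} uniq 2^|GV|<|X| with majority-fibre (h G) X
... | b , |X|≤2|Xb|
  with columns-collide h V (fibre⁺ uniq) (*-cancelˡ-< 2 _ _ (<-≤-trans 2^|GV|<|X| |X|≤2|Xb|))
... | j , l , j∈Xb , l∈Xb , j≢l , same with ∈-fibre⁻ j∈Xb | ∈-fibre⁻ l∈Xb
... | j∈X , hGj | l∈X , hGl = j , l , j∈X , l∈X , j≢l , trans hGj (sym hGl) ∷ same

eighth<quarter : ∀ {m z} → 3 ≤ m → 2 ^ m ≤ 2 * (2 * z) → 2 ^ (m ∸ 3) + 1 ≤ z
eighth<quarter {m} {z} 3≤m 2^m≤4z = begin
  k + 1      ≤⟨ +-monoʳ-≤ k (m^n>0 2 (m ∸ 3)) ⟩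
  k + k      ≡⟨ cong (k +_) (sym (+-identityʳ k)) ⟩
  2 * k      ≤⟨ *-cancelˡ-≤ 4 (begin
    4 * (2 * k)         ≡⟨ *-assoc 4 2 k ⟨
    2 ^ 3 * k           ≡⟨ ^-distribˡ-+-* 2 3 (m ∸ 3) ⟨
    2 ^ (3 + (m ∸ 3))   ≡⟨ cong (2 ^_) (m+[n∸m]≡n 3≤m) ⟩
    2 ^ m               ≤⟨ 2^m≤4z ⟩
    2 * (2 * z)         ≡⟨ *-assoc 2 2 z ⟨
    4 * z               ∎) ⟩
  z          ∎
  where
  open ≤-Reasoning
  k : ℕ
  k = 2 ^ (m ∸ 3)

homogeneous-subset : ∀ {n} (p q : Graph n → Bool) {V : List (Graph n)} {m'} →
  3 ≤ m' → length V ≡ 2 ^ m' → Unique V →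
  ∃[ S ] (IsSubsetOfSize S V (2 ^ (m' ∸ 3) + 1) ×
          (∀ {G H} → G ∈ S → H ∈ S → p G ≡ p H × q G ≡ q H))
homogeneous-subset p q {V} {m'} 3≤m' |V|≡2^m' uniq
  with x , |V|≤2|Y| ← majority-fibre p V
  with y , |Y|≤2|Z| ← majority-fibre q (fibre p x V) =
  S , S-in-V , homogeneous
  where
  Y : List (Graph _)
  Y = fibre p x V
  Z : List (Graph _)
  Z = fibre q y Y
  k : ℕ
  k = 2 ^ (m' ∸ 3)

  labels : ∀ {G} → G ∈ Z → G ∈ V × p G ≡ x × q G ≡ y
  labels G∈Z with G∈Y , qG≡y ← ∈-fibre⁻ G∈Z with G∈V , pG≡x ← ∈-fibre⁻ G∈Y = G∈V , pG≡x , qG≡y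

  k+1≤|Z| : k + 1 ≤ length Z
  k+1≤|Z| = eighth<quarter 3≤m' (begin
    2 ^ m'                ≡⟨ |V|≡2^m' ⟨
    length V              ≤⟨ |V|≤2|Y| ⟩
    2 * length Y          ≤⟨ *-monoʳ-≤ 2 |Y|≤2|Z| ⟩
    2 * (2 * length Z)    ∎)
    where open ≤-Reasoning

  S : List (Graph _)
  S = take (k + 1) Z

  S-in-Z : IsSubsetOfSize S Z (k + 1)
  S-in-Z = take-isSubsetOfSize (fibre⁺ (fibre⁺ uniq)) k+1≤|Z|

  S⊆Z : All (_∈ Z) S
  S⊆Z = proj₁ (proj₂ S-in-Z)

  S-in-V : IsSubsetOfSize S V (k + 1)
  S-in-V = proj₁ S-in-Z , All.map (proj₁ ∘ labels) S⊆Z , proj₂ (proj₂ S-in-Z)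

  homogeneous : ∀ {G H} → G ∈ S → H ∈ S → p G ≡ p H × q G ≡ q H
  homogeneous G∈S H∈S with _ , pG , qG ← labels (All.lookup S⊆Z G∈S)
                         | _ , pH , qH ← labels (All.lookup S⊆Z H∈S) =
    trans pG (sym pH) , trans qG (sym qH)

twin-edges⇒¬useful : ∀ {n} {V : List (Graph n)} {a b c : Fin n} → a ≢ b → b ≢ c → a ≢ c →
  All (λ G → adj G a b ≡ adj G a c) V → Unique V → ¬ UsefulForTriangles V
twin-edges⇒¬useful {V = V} {a} {b} {c} a≢b b≢c a≢c twins uniq (m' , 3≤m' , |V|≡2^m' , useful) =
  let S , S-size , homogeneous =
        homogeneous-subset (λ G → adj G a b) (λ G → adj G b c) 3≤m' |V|≡2^m' uniq
      G₁ , G₂ , G₁∈S , G₂∈S , _ , triangle-free = useful S S-size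
      S⊆V = proj₁ (proj₂ S-size)
      ab , bc = homogeneous G₁∈S G₂∈S
      ac = begin
        adj G₁ a c   ≡⟨ All.lookup twins (All.lookup S⊆V G₁∈S) ⟨
        adj G₁ a b   ≡⟨ ab ⟩
        adj G₂ a b   ≡⟨ All.lookup twins (All.lookup S⊆V G₂∈S) ⟩
        adj G₂ a c   ∎
  in agreement-triangle G₁ G₂ a≢b b≢c a≢c ab bc ac triangle-free
  where open ≡-Reasoning

useful⇒order≤1+2^size : ∀ {n} {V : List (Graph (suc n))} → Unique V → UsefulForTriangles V →
  n ≤ 2 ^ length V
useful⇒order≤1+2^size {n} {V} uniq useful = ≮⇒≥ λ 2^|V|<n →
  let _ , _ , _ , _ , j≢l , twins =
        columns-collide (λ G j → adj G Fin.zero (Fin.suc j)) V (Unique.allFin⁺ n)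
          (<-≤-trans 2^|V|<n (≤-reflexive (sym (length-tabulate id))))
  in twin-edges⇒¬useful Finₚ.0≢1+n (j≢l ∘ Finₚ.suc-injective) Finₚ.0≢1+n twins uniq useful

proposition3 : (m : ℕ) → ∃[ N ] ((n : ℕ) → 1 ≤ n → (V : List (Graph n)) →
    Unique V → UsefulForTriangles V → length V ≤ 2 ^ m → n ≤ N)
proposition3 m = suc (2 ^ 2 ^ m) , order-bound
  where
  order-bound : (n : ℕ) → 1 ≤ n → (V : List (Graph n)) →
    Unique V → UsefulForTriangles V → length V ≤ 2 ^ m → n ≤ suc (2 ^ 2 ^ m)
  order-bound (suc n) _ V uniq useful |V|≤2^m =
    s≤s (≤-trans (useful⇒order≤1+2^size uniq useful) (^-monoʳ-≤ 2 |V|≤2^m))
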